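{- Let $t\geq 3$ and $k\geq 1$ be odd integers and let $G=D(1,t)$. Then $\mathrm{rl}_k(G)\leq \frac t2 k^2-\frac12$.
   Context: For a finite set $D=\{d_1<\dots<d_m\}$ of positive integers, the distance graph $D(d_1,\dots,d_m)$ has vertex set $\mathbb{Z}$, two distinct integers $i,j$ being adjacent iff $|i-j|\in D$. For a connected graph $G$ with graph distance $d(\cdot,\cdot)$ and an integer $k\ge 1$, a radio $k$-labeling of $G$ is a map $c:V(G)\to\mathbb{Z}_{\ge 0}$ such that $|c(u)-c(v)|\geq k+1-d(u,v)$ for all distinct vertices $u,v$. Its span is $\max\{c(x)-c(y): x,y\in V(G)\}$ (a supremum for infinite graphs), and the radio $k$-labeling number $\mathrm{rl}_k(G)$ is the minimum span over all radio $k$-labelings of $G$. -}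

module Defs where

open import Data.Nat using (ℕ; zero; suc; _+_; _*_; _≤_)
open import Data.Integer using (ℤ; ∣_∣; _-_)
open import Data.List using (List)
open import Data.List.Membership.Propositional using (_∈_)
open import Data.Product using (Σ; _×_)
open import Relation.Binary.PropositionalEquality using (_≡_; _≢_)

Odd : ℕ → Set
Odd n = Σ ℕ λ m → n ≡ 2 * m + 1

Adj : List ℕ → ℤ → ℤ → Set
Adj D i j = ∣ i - j ∣ ∈ D

data Walk (D : List ℕ) : ℤ → ℤ → ℕ → Set where
  here : ∀ {u} → Walk D u u zero
  step : ∀ {u w v n} → Adj D u w → Walk D w v n → Walk D u v (suc n)

IsDist : List ℕ → ℤ → ℤ → ℕ → Set
IsDist D u v d = Walk D u v d × (∀ m → Walk D u v m → d ≤ m)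

-- Radio k-labeling c : ℤ → ℤ≥0 (= ℕ) of D:
-- |c(u) - c(v)| ≥ k + 1 - d(u,v) for all distinct u, v,
-- written without truncated subtraction as k + 1 ≤ |c u - c v| + d(u,v).
IsRadioLabeling : List ℕ → ℕ → (ℤ → ℕ) → Set
IsRadioLabeling D k c =
  ∀ u v d → u ≢ v → IsDist D u v d →
    k + 1 ≤ ∣ Data.Integer.+ c u - Data.Integer.+ c v ∣ + d

SpanAtMost : (ℤ → ℕ) → ℕ → Set
SpanAtMost c N = ∀ x y → c x ≤ c y + N

-- rl_k(D) ≤ N : some radio k-labeling has span at most N
-- (rl_k is the minimum span, a minimum of a set of naturals/∞).
RadioNumberAtMost : List ℕ → ℕ → ℕ → Set
RadioNumberAtMost D k N = Σ (ℤ → ℕ) λ c → IsRadioLabeling D k c × SpanAtMost c N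

-- Let M = (t k² + 1) / 2 and label u ∈ ℤ by c(u) = k u mod M ∈ [0, M - 1], which has the
-- claimed span.  Since t k · k = 2M - 1, the number (u - v) + t k (c(u) - c(v)) is a multiple
-- of M.  A walk of length d from u to v in D(1,t) writes u - v = a + t b with |a| + |b| ≤ d, so
-- a violation |c(u) - c(v)| + d ≤ k of the radio condition gives a multiple a + t b + t k r of M
-- with |a| + |b| + |r| ≤ k and a + t b ≠ 0.  Such a multiple lies strictly between -2M and 2M;
-- it is not 0, since that forces r = 0, and it is not ±M, by a case analysis on the signs of
-- r - m and q = m - b + k (m - r), where t = 2n + 1 and k = 2m + 1.

module Submission where

open import Data.List using (_∷_; [])
open import Data.Product using (_,_; ∃; ∃₂; _×_)
open import Data.Empty using (⊥-elim)
open import Data.Sum using (_⊎_; inj₁; inj₂)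
open import Relation.Binary.PropositionalEquality
  using (_≡_; _≢_; refl; sym; trans; cong; cong₂; subst; subst₂)
open import Relation.Nullary using (yes; no)

open import Defs
open import Data.Nat.Base as ℕ using (ℕ)
open import Data.Integer.Base using (ℤ)

module OddNumbers where
  open import Data.Nat
  open import Data.Nat.Properties using (m+n∸n≡m; n≡⌊n+n/2⌋; +-identityʳ)
  open import Data.Nat.Tactic.RingSolver using (solve-∀)
  open import Relation.Binary.PropositionalEquality using (module ≡-Reasoning)
  open ≡-Reasoning

  odd-* : ∀ {a b} → Odd a → Odd b → Odd (a * b)
  odd-* (x , refl) (y , refl) = 2 * x * y + x + y , product x y
    where
      product : ∀ x y → (2 * x + 1) * (2 * y + 1) ≡ 2 * (2 * x * y + x + y) + 1
      product = solve-∀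

  ⌊2j+1∸1/2⌋≡j : ∀ j → ⌊ 2 * j + 1 ∸ 1 /2⌋ ≡ j
  ⌊2j+1∸1/2⌋≡j j = begin
    ⌊ 2 * j + 1 ∸ 1 /2⌋   ≡⟨ cong ⌊_/2⌋ (m+n∸n≡m (2 * j) 1) ⟩
    ⌊ j + (j + 0) /2⌋     ≡⟨ cong (λ x → ⌊ j + x /2⌋) (+-identityʳ j) ⟩
    ⌊ j + j /2⌋           ≡⟨ sym (n≡⌊n+n/2⌋ j) ⟩
    j                     ∎

  odd⇒2*suc⌊n∸1/2⌋≡n+1 : ∀ {n} → Odd n → 2 * suc ⌊ n ∸ 1 /2⌋ ≡ n + 1
  odd⇒2*suc⌊n∸1/2⌋≡n+1 (j , refl) = begin
    2 * suc ⌊ 2 * j + 1 ∸ 1 /2⌋  ≡⟨ cong (λ h → 2 * suc h) (⌊2j+1∸1/2⌋≡j j) ⟩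
    2 * suc j                    ≡⟨ twice-suc j ⟩
    2 * j + 1 + 1                ∎
    where
      twice-suc : ∀ j → 2 * suc j ≡ 2 * j + 1 + 1
      twice-suc = solve-∀

module DistanceGraph (t : ℕ) where
  open import Data.Integer
  open import Data.Integer.Properties
    using ( ∣i+j∣≤∣i∣+∣j∣; +-identityˡ; +-identityʳ; +-inverseʳ; *-zeroʳ; *-identityʳ; *-comm; -1*i≡-i
          ; module ≤-Reasoning)
  open import Data.Integer.Tactic.RingSolver using (solve; solve-∀)
  open import Data.List.Relation.Unary.Any using (here; there)
  import Data.Nat.Properties as ℕ
  open import Algebra.Properties.CommutativeSemigroup ℕ.+-commutativeSemigroup using (interchange)

  i≡∣i∣*unit : ∀ i → ∃ λ ε → i ≡ + ∣ i ∣ * ε × ∣ ε ∣ ≡ 1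
  i≡∣i∣*unit (+ n)    = 1ℤ , sym (*-identityʳ (+ n)) , refl
  i≡∣i∣*unit -[1+ n ] = -1ℤ , sym (trans (*-comm +[1+ n ] -1ℤ) (-1*i≡-i +[1+ n ])) , refl

  edge-offset : ∀ {u w} → Adj (1 ∷ t ∷ []) u w →
                ∃₂ λ a b → u - w ≡ a + + t * b × ∣ a ∣ ℕ.+ ∣ b ∣ ≡ 1
  edge-offset {u} {w} (here ∣u-w∣≡1) =
    u - w , 0ℤ , sym (trans (cong (λ x → (u - w) + x) (*-zeroʳ (+ t))) (+-identityʳ (u - w))) ,
    trans (ℕ.+-identityʳ ∣ u - w ∣) ∣u-w∣≡1
  edge-offset {u} {w} (there (here ∣u-w∣≡t)) with i≡∣i∣*unit (u - w)
  ... | ε , u-w≡ , ∣ε∣≡1 =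
    0ℤ , ε , trans u-w≡ (trans (cong (λ s → + s * ε) ∣u-w∣≡t) (sym (+-identityˡ (+ t * ε)))) , ∣ε∣≡1

  walk-offset : ∀ {u v d} → Walk (1 ∷ t ∷ []) u v d →
                ∃₂ λ a b → u - v ≡ a + + t * b × ∣ a ∣ ℕ.+ ∣ b ∣ ℕ.≤ d
  walk-offset {u} here =
    0ℤ , 0ℤ , trans (+-inverseʳ u) (sym (trans (+-identityˡ (+ t * 0ℤ)) (*-zeroʳ (+ t)))) , ℕ.z≤n
  walk-offset {u} {v} (step {w = w} {n = d} adj rest) with edge-offset {u} {w} adj | walk-offset rest
  ... | a₁ , b₁ , u-w≡ , ∣a₁∣+∣b₁∣≡1 | a₂ , b₂ , w-v≡ , ∣a₂∣+∣b₂∣≤d =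
    a₁ + a₂ , b₁ + b₂ , offset , length
    where
      regroup : ∀ T a₁ b₁ a₂ b₂ → (a₁ + T * b₁) + (a₂ + T * b₂) ≡ (a₁ + a₂) + T * (b₁ + b₂)
      regroup = solve-∀

      offset : u - v ≡ (a₁ + a₂) + + t * (b₁ + b₂)
      offset = begin-equality
        u - v                                 ≡⟨ solve (u ∷ w ∷ v ∷ []) ⟩
        (u - w) + (w - v)                     ≡⟨ cong₂ _+_ u-w≡ w-v≡ ⟩
        (a₁ + + t * b₁) + (a₂ + + t * b₂)     ≡⟨ regroup (+ t) a₁ b₁ a₂ b₂ ⟩
        (a₁ + a₂) + + t * (b₁ + b₂)           ∎
        where open ≤-Reasoning

      length : ∣ a₁ + a₂ ∣ ℕ.+ ∣ b₁ + b₂ ∣ ℕ.≤ ℕ.suc d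
      length = begin
        ∣ a₁ + a₂ ∣ ℕ.+ ∣ b₁ + b₂ ∣                   ≤⟨ ℕ.+-mono-≤ (∣i+j∣≤∣i∣+∣j∣ a₁ a₂) (∣i+j∣≤∣i∣+∣j∣ b₁ b₂) ⟩
        (∣ a₁ ∣ ℕ.+ ∣ a₂ ∣) ℕ.+ (∣ b₁ ∣ ℕ.+ ∣ b₂ ∣)   ≡⟨ interchange (∣ a₁ ∣) (∣ a₂ ∣) (∣ b₁ ∣) (∣ b₂ ∣) ⟩
        (∣ a₁ ∣ ℕ.+ ∣ b₁ ∣) ℕ.+ (∣ a₂ ∣ ℕ.+ ∣ b₂ ∣)   ≡⟨ cong (ℕ._+ (∣ a₂ ∣ ℕ.+ ∣ b₂ ∣)) ∣a₁∣+∣b₁∣≡1 ⟩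
        ℕ.suc (∣ a₂ ∣ ℕ.+ ∣ b₂ ∣)                     ≤⟨ ℕ.s≤s ∣a₂∣+∣b₂∣≤d ⟩
        ℕ.suc d                                       ∎
        where open ℕ.≤-Reasoning

module ShortVectors where
  open import Data.Integer
  open import Data.Integer.Properties
  open import Data.Integer.Divisibility.Signed using (_∣_; divides)
  open import Data.Integer.Tactic.RingSolver using (solve)
  open import Data.Nat using (z≤n; s≤s)
  import Data.Nat.Properties as ℕ

  ℓ₁ : ℤ → ℤ → ℤ → ℤ
  ℓ₁ a b r = + ∣ a ∣ + + ∣ b ∣ + + ∣ r ∣

  ℓ₁-neg : ∀ a b r → ℓ₁ (- a) (- b) (- r) ≡ ℓ₁ a b r
  ℓ₁-neg a b r = cong₂ _+_ (cong₂ _+_ (cong +_ (∣-i∣≡∣i∣ a)) (cong +_ (∣-i∣≡∣i∣ b))) (cong +_ (∣-i∣≡∣i∣ r))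

  i≤∣i∣ : ∀ i → i ≤ + ∣ i ∣
  i≤∣i∣ (+ n)    = ≤-refl
  i≤∣i∣ -[1+ n ] = -≤+

  -i≤∣i∣ : ∀ i → - i ≤ + ∣ i ∣
  -i≤∣i∣ i = subst (λ n → - i ≤ + n) (∣-i∣≡∣i∣ i) (i≤∣i∣ (- i))

  0≤i+j : ∀ {i j} → 0ℤ ≤ i → 0ℤ ≤ j → 0ℤ ≤ i + j
  0≤i+j = +-mono-≤

  0≤i*j : ∀ {i j} → 0ℤ ≤ i → 0ℤ ≤ j → 0ℤ ≤ i * j
  0≤i*j {j = j} 0≤i 0≤j = *-monoʳ-≤-nonNeg j {{nonNegative 0≤j}} 0≤i

  i≤i+slack : ∀ i {j} → 0ℤ ≤ j → i ≤ i + j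
  i≤i+slack i 0≤j = i≤i+j i _ {{nonNegative 0≤j}}

  ≤⊎suc≤ : ∀ i j → i ≤ j ⊎ suc j ≤ i
  ≤⊎suc≤ i j with i ≤? j
  ... | yes i≤j = inj₁ i≤j
  ... | no  i≰j = inj₂ (i<j⇒suc[i]≤j (≰⇒> i≰j))

  module Lattice {t k n m M : ℤ}
    (t≡2n+1 : t ≡ + 2 * n + + 1) (1≤n : + 1 ≤ n)
    (k≡2m+1 : k ≡ + 2 * m + + 1) (0≤m : 0ℤ ≤ m)
    (2M≡tk²+1 : + 2 * M ≡ t * k * k + + 1) where

    open ≤-Reasoning

    0≤n : 0ℤ ≤ n
    0≤n = ≤-trans (+≤+ z≤n) 1≤n

    0≤n-1 : 0ℤ ≤ n - + 1
    0≤n-1 = i≤j⇒0≤j-i 1≤n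

    0≤t-n-2 : 0ℤ ≤ t - n - + 2
    0≤t-n-2 = begin
      0ℤ                        ≤⟨ 0≤n-1 ⟩
      n - + 1                   ≡⟨ solve (n ∷ []) ⟩
      + 2 * n + + 1 - n - + 2   ≡⟨ cong (λ t → t - n - + 2) t≡2n+1 ⟨
      t - n - + 2               ∎

    0≤t-1 : 0ℤ ≤ t - + 1
    0≤t-1 = begin
      0ℤ                              ≤⟨ 0≤i+j (0≤i+j 0≤t-n-2 0≤n-1) (+≤+ z≤n) ⟩
      (t - n - + 2) + (n - + 1) + + 2 ≡⟨ solve (t ∷ n ∷ []) ⟩
      t - + 1                         ∎

    0≤t : 0ℤ ≤ t
    0≤t = begin
      0ℤ              ≤⟨ 0≤i+j 0≤t-1 (+≤+ z≤n) ⟩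
      t - + 1 + + 1   ≡⟨ solve (t ∷ []) ⟩
      t               ∎

    0≤k-1 : 0ℤ ≤ k - + 1
    0≤k-1 = begin
      0ℤ                    ≤⟨ 0≤i*j {+ 2} (+≤+ z≤n) 0≤m ⟩
      + 2 * m               ≡⟨ solve (m ∷ []) ⟩
      + 2 * m + + 1 - + 1   ≡⟨ cong (_- + 1) k≡2m+1 ⟨
      k - + 1               ∎

    0≤k : 0ℤ ≤ k
    0≤k = begin
      0ℤ              ≤⟨ 0≤i+j 0≤k-1 (+≤+ z≤n) ⟩
      k - + 1 + + 1   ≡⟨ solve (k ∷ []) ⟩
      k               ∎

    1+k≡2m+2 : + 1 + k ≡ + 2 * m + + 2
    1+k≡2m+2 = begin-equality
      + 1 + k               ≡⟨ cong (λ k → + 1 + k) k≡2m+1 ⟩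
      + 1 + (+ 2 * m + + 1) ≡⟨ solve (m ∷ []) ⟩
      + 2 * m + + 2         ∎

    M≡t[m+km]+n+1 : M ≡ t * (m + k * m) + n + + 1
    M≡t[m+km]+n+1 = *-cancelˡ-≡ (+ 2) M (t * (m + k * m) + n + + 1) (begin-equality
      + 2 * M                                                 ≡⟨ 2M≡tk²+1 ⟩
      t * k * k + + 1                                         ≡⟨ cong₂ (λ t k → t * k * k + + 1) t≡2n+1 k≡2m+1 ⟩
      (+ 2 * n + + 1) * (+ 2 * m + + 1) * (+ 2 * m + + 1) + + 1 ≡⟨ solve (n ∷ m ∷ []) ⟩
      + 2 * ((+ 2 * n + + 1) * (m + (+ 2 * m + + 1) * m) + n + + 1)
        ≡⟨ cong₂ (λ t k → + 2 * (t * (m + k * m) + n + + 1)) t≡2n+1 k≡2m+1 ⟨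
      + 2 * (t * (m + k * m) + n + + 1)                       ∎)

    0≤M : 0ℤ ≤ M
    0≤M = begin
      0ℤ                           ≤⟨ 0≤i+j (0≤i+j (0≤i*j 0≤t (0≤i+j 0≤m (0≤i*j 0≤k 0≤m))) 0≤n) (+≤+ z≤n) ⟩
      t * (m + k * m) + n + + 1    ≡⟨ M≡t[m+km]+n+1 ⟨
      M                            ∎

    L : ℤ → ℤ → ℤ → ℤ
    L a b r = a + t * b + t * k * r

    ±a±b+r≤ℓ₁ : ∀ a b {r x y} → x ≤ + ∣ a ∣ → y ≤ + ∣ b ∣ → x + y + r ≤ ℓ₁ a b r
    ±a±b+r≤ℓ₁ a b {r} x≤∣a∣ y≤∣b∣ = +-mono-≤ (+-mono-≤ x≤∣a∣ y≤∣b∣) (i≤∣i∣ r)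

    L-neg : ∀ a b r → L (- a) (- b) (- r) ≡ - L a b r
    L-neg a b r = begin-equality
      - a + t * - b + t * k * - r   ≡⟨ solve (a ∷ b ∷ r ∷ t ∷ k ∷ []) ⟩
      - (a + t * b + t * k * r)     ∎

    -- The solutions of L a b r ≡ 0 and of L a b r ≡ M, parametrized by (b, r) and by (q, r).
    -- In each sign case a signed sum ±a ± b + r is k + 1 plus a sum of nonnegative terms.
    k<ℓ₁-at-level-0 : ∀ b r → + 1 ≤ r → k < ℓ₁ (- (t * (b + k * r))) b r
    k<ℓ₁-at-level-0 b r 1≤r = suc[i]≤j⇒i<j (by-sign (≤⊎suc≤ (b + k * r) 0ℤ))
      where
        a = - (t * (b + k * r))
        0≤r-1 = i≤j⇒0≤j-i 1≤r
        by-sign : b + k * r ≤ 0ℤ ⊎ + 1 ≤ b + k * r → + 1 + k ≤ ℓ₁ a b r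
        by-sign (inj₁ s≤0) = begin
          + 1 + k
            ≤⟨ i≤i+slack _ (0≤i+j (0≤i*j (0≤i+j 0≤t (+≤+ z≤n)) (neg-mono-≤ s≤0))
                                   (0≤i*j (0≤i+j 0≤k (+≤+ z≤n)) 0≤r-1)) ⟩
          + 1 + k + ((t + + 1) * (- (b + k * r)) + (k + + 1) * (r - + 1))
            ≡⟨ solve (t ∷ k ∷ b ∷ r ∷ []) ⟩
          - (t * (b + k * r)) - b + r
            ≤⟨ ±a±b+r≤ℓ₁ a b (i≤∣i∣ a) (-i≤∣i∣ b) ⟩
          ℓ₁ a b r ∎
        by-sign (inj₂ 1≤s) = begin
          + 1 + k
            ≤⟨ i≤i+slack _ (0≤i+j (0≤i*j 0≤t-1 (≤-trans (+≤+ z≤n) 1≤s))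
                                   (0≤i*j (0≤i+j 0≤k (+≤+ z≤n)) 0≤r-1)) ⟩
          + 1 + k + ((t - + 1) * (b + k * r) + (k + + 1) * (r - + 1))
            ≡⟨ solve (t ∷ k ∷ b ∷ r ∷ []) ⟩
          - - (t * (b + k * r)) - b + r
            ≤⟨ ±a±b+r≤ℓ₁ a b (-i≤∣i∣ a) (-i≤∣i∣ b) ⟩
          ℓ₁ a b r ∎

    k<ℓ₁-at-level-M : ∀ q r → k < ℓ₁ (t * q + n + + 1) (m - q + k * (m - r)) r
    k<ℓ₁-at-level-M q r = suc[i]≤j⇒i<j (by-signs (≤⊎suc≤ q -1ℤ) (≤⊎suc≤ r m))
      where
        a = t * q + n + + 1
        b = m - q + k * (m - r)
        by-signs : q ≤ -1ℤ ⊎ 0ℤ ≤ q → r ≤ m ⊎ + 1 + m ≤ r → + 1 + k ≤ ℓ₁ a b r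
        by-signs (inj₂ 0≤q) (inj₁ r≤m) = begin
          + 1 + k
            ≡⟨ 1+k≡2m+2 ⟩
          + 2 * m + + 2
            ≤⟨ i≤i+slack _ (0≤i+j (0≤i+j (0≤i*j 0≤t-1 0≤q) (0≤i*j 0≤k-1 (i≤j⇒0≤j-i r≤m))) 0≤n-1) ⟩
          + 2 * m + + 2 + ((t - + 1) * q + (k - + 1) * (m - r) + (n - + 1))
            ≡⟨ solve (t ∷ k ∷ n ∷ m ∷ q ∷ r ∷ []) ⟩
          (t * q + n + + 1) + (m - q + k * (m - r)) + r
            ≤⟨ ±a±b+r≤ℓ₁ a b (i≤∣i∣ a) (i≤∣i∣ b) ⟩
          ℓ₁ a b r ∎
        by-signs (inj₁ q≤-1) (inj₁ r≤m) = begin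
          + 1 + k
            ≡⟨ 1+k≡2m+2 ⟩
          + 2 * m + + 2
            ≤⟨ i≤i+slack _ (0≤i+j (0≤i+j (0≤i*j (0≤i+j 0≤t (+≤+ z≤n)) (i≤j⇒0≤j-i q≤-1)) 0≤t-n-2)
                                   (0≤i*j 0≤k-1 (i≤j⇒0≤j-i r≤m))) ⟩
          + 2 * m + + 2 + ((t + + 1) * (-1ℤ - q) + (t - n - + 2) + (k - + 1) * (m - r))
            ≡⟨ solve (t ∷ k ∷ n ∷ m ∷ q ∷ r ∷ []) ⟩
          - (t * q + n + + 1) + (m - q + k * (m - r)) + r
            ≤⟨ ±a±b+r≤ℓ₁ a b (-i≤∣i∣ a) (i≤∣i∣ b) ⟩
          ℓ₁ a b r ∎
        by-signs (inj₂ 0≤q) (inj₂ 1+m≤r) = begin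
          + 1 + k
            ≤⟨ i≤i+slack _ (0≤i+j (0≤i+j (0≤i*j (0≤i+j 0≤t (+≤+ z≤n)) 0≤q) (0≤i+j 0≤n (+≤+ z≤n)))
                                   (0≤i*j (0≤i+j 0≤k (+≤+ z≤n)) (i≤j⇒0≤j-i 1+m≤r))) ⟩
          + 1 + k + ((t + + 1) * q + (n + + 1) + (k + + 1) * (r - (+ 1 + m)))
            ≡⟨ solve (t ∷ k ∷ n ∷ m ∷ q ∷ r ∷ []) ⟩
          (t * q + n + + 1) - (m - q + k * (m - r)) + r
            ≤⟨ ±a±b+r≤ℓ₁ a b (i≤∣i∣ a) (-i≤∣i∣ b) ⟩
          ℓ₁ a b r ∎
        by-signs (inj₁ q≤-1) (inj₂ 1+m≤r) = begin
          + 1 + k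
            ≤⟨ i≤i+slack _ (0≤i+j (0≤i+j 0≤t-n-2 (0≤i*j 0≤t-1 (i≤j⇒0≤j-i q≤-1)))
                                   (0≤i*j (0≤i+j 0≤k (+≤+ z≤n)) (i≤j⇒0≤j-i 1+m≤r))) ⟩
          + 1 + k + ((t - n - + 2) + (t - + 1) * (-1ℤ - q) + (k + + 1) * (r - (+ 1 + m)))
            ≡⟨ solve (t ∷ k ∷ n ∷ m ∷ q ∷ r ∷ []) ⟩
          - (t * q + n + + 1) - (m - q + k * (m - r)) + r
            ≤⟨ ±a±b+r≤ℓ₁ a b (-i≤∣i∣ a) (-i≤∣i∣ b) ⟩
          ℓ₁ a b r ∎

    L≤tkℓ₁ : ∀ a b r → L a b r ≤ t * k * ℓ₁ a b r
    L≤tkℓ₁ a b r = begin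
      a + t * b + t * k * r
        ≤⟨ +-mono-≤ (+-mono-≤ (i≤∣i∣ a) (*-monoˡ-≤-nonNeg t {{nonNegative 0≤t}} (i≤∣i∣ b)))
                    (*-monoˡ-≤-nonNeg (t * k) {{nonNegative (0≤i*j 0≤t 0≤k)}} (i≤∣i∣ r)) ⟩
      + ∣ a ∣ + t * + ∣ b ∣ + t * k * + ∣ r ∣
        ≤⟨ weighted≤ (+≤+ z≤n) (+≤+ z≤n) ⟩
      t * k * ℓ₁ a b r ∎
      where
        weighted≤ : ∀ {A B R} → 0ℤ ≤ A → 0ℤ ≤ B → A + t * B + t * k * R ≤ t * k * (A + B + R)
        weighted≤ {A} {B} {R} 0≤A 0≤B = begin
          A + t * B + t * k * R
            ≤⟨ i≤i+slack _ (0≤i+j (0≤i*j (0≤i+j (0≤i*j 0≤t-1 0≤k) 0≤k-1) 0≤A)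
                                   (0≤i*j (0≤i*j 0≤t 0≤k-1) 0≤B)) ⟩
          A + t * B + t * k * R + (((t - + 1) * k + (k - + 1)) * A + t * (k - + 1) * B)
            ≡⟨ solve (t ∷ k ∷ A ∷ B ∷ R ∷ []) ⟩
          t * k * (A + B + R) ∎

    L≡0⇒k<ℓ₁ : ∀ a b r → L a b r ≡ 0ℤ → + 1 ≤ r → k < ℓ₁ a b r
    L≡0⇒k<ℓ₁ a b r L≡0 1≤r = subst (λ a → k < ℓ₁ a b r) (sym a≡) (k<ℓ₁-at-level-0 b r 1≤r)
      where
        a≡ : a ≡ - (t * (b + k * r))
        a≡ = begin-equality
          a                                           ≡⟨ solve (a ∷ b ∷ r ∷ t ∷ k ∷ []) ⟩
          (a + t * b + t * k * r) - t * (b + k * r)   ≡⟨ cong (λ x → x - t * (b + k * r)) L≡0 ⟩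
          0ℤ - t * (b + k * r)                        ≡⟨ solve (b ∷ r ∷ t ∷ k ∷ []) ⟩
          - (t * (b + k * r))                         ∎

    L≡M⇒k<ℓ₁ : ∀ a b r → L a b r ≡ M → k < ℓ₁ a b r
    L≡M⇒k<ℓ₁ a b r L≡M = subst₂ (λ a b → k < ℓ₁ a b r) (sym a≡) (sym b≡) (k<ℓ₁-at-level-M q r)
      where
        q = m - b + k * (m - r)
        a≡ : a ≡ t * q + n + + 1
        a≡ = begin-equality
          a                                             ≡⟨ solve (a ∷ b ∷ r ∷ t ∷ k ∷ []) ⟩
          (a + t * b + t * k * r) - t * (b + k * r)     ≡⟨ cong (λ x → x - t * (b + k * r)) (trans L≡M M≡t[m+km]+n+1) ⟩
          t * (m + k * m) + n + + 1 - t * (b + k * r)   ≡⟨ solve (t ∷ k ∷ n ∷ m ∷ b ∷ r ∷ []) ⟩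
          t * (m - b + k * (m - r)) + n + + 1           ∎
        b≡ : b ≡ m - q + k * (m - r)
        b≡ = begin-equality
          b                                     ≡⟨ solve (k ∷ m ∷ b ∷ r ∷ []) ⟩
          m - (m - b + k * (m - r)) + k * (m - r) ∎

    L≡[2+p]M⇒k<ℓ₁ : ∀ p a b r → L a b r ≡ + (2 ℕ.+ p) * M → k < ℓ₁ a b r
    L≡[2+p]M⇒k<ℓ₁ p a b r L≡ = *-cancelˡ-<-nonNeg (t * k) {{nonNegative (0≤i*j 0≤t 0≤k)}} (begin-strict
      t * k * k               <⟨ suc[i]≤j⇒i<j (≤-reflexive (+-comm (+ 1) (t * k * k))) ⟩
      t * k * k + + 1         ≡⟨ 2M≡tk²+1 ⟨
      + 2 * M                 ≤⟨ *-monoʳ-≤-nonNeg M {{nonNegative 0≤M}} (+≤+ (ℕ.m≤m+n 2 p)) ⟩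
      + (2 ℕ.+ p) * M         ≡⟨ L≡ ⟨
      L a b r                 ≤⟨ L≤tkℓ₁ a b r ⟩
      t * k * ℓ₁ a b r        ∎)

    L≡[+p]M⇒k<ℓ₁ : ∀ p a b r → L a b r ≡ + p * M → a + t * b ≢ 0ℤ → k < ℓ₁ a b r
    L≡[+p]M⇒k<ℓ₁ 0 a b (+ 0) L≡0 ≢0 = ⊥-elim (≢0 (begin-equality
      a + t * b                 ≡⟨ solve (a ∷ b ∷ t ∷ k ∷ []) ⟩
      a + t * b + t * k * + 0   ≡⟨ L≡0 ⟩
      0ℤ                        ∎))
    L≡[+p]M⇒k<ℓ₁ 0 a b +[1+ r ] L≡0 _ = L≡0⇒k<ℓ₁ a b +[1+ r ] L≡0 (+≤+ (s≤s z≤n))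
    L≡[+p]M⇒k<ℓ₁ 0 a b -[1+ r ] L≡0 _ = subst (k <_) (ℓ₁-neg a b -[1+ r ])
      (L≡0⇒k<ℓ₁ (- a) (- b) +[1+ r ] (trans (L-neg a b -[1+ r ]) (cong -_ L≡0)) (+≤+ (s≤s z≤n)))
    L≡[+p]M⇒k<ℓ₁ 1 a b r L≡M _ = L≡M⇒k<ℓ₁ a b r (trans L≡M (*-identityˡ M))
    L≡[+p]M⇒k<ℓ₁ (ℕ.suc (ℕ.suc p)) a b r L≡ _ = L≡[2+p]M⇒k<ℓ₁ p a b r L≡

    L≡pM⇒k<ℓ₁ : ∀ p a b r → L a b r ≡ p * M → a + t * b ≢ 0ℤ → k < ℓ₁ a b r
    L≡pM⇒k<ℓ₁ (+ p) = L≡[+p]M⇒k<ℓ₁ p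
    L≡pM⇒k<ℓ₁ -[1+ p ] a b r L≡ ≢0 = subst (k <_) (ℓ₁-neg a b r) (L≡[+p]M⇒k<ℓ₁ (ℕ.suc p) (- a) (- b) (- r) L′≡ ≢0′)
      where
        L′≡ : L (- a) (- b) (- r) ≡ +[1+ p ] * M
        L′≡ = trans (L-neg a b r) (trans (cong -_ L≡) (neg-distribˡ-* -[1+ p ] M))

        ≢0′ : - a + t * - b ≢ 0ℤ
        ≢0′ ≡0 = ≢0 (begin-equality
          a + t * b          ≡⟨ solve (a ∷ b ∷ t ∷ []) ⟩
          - (- a + t * - b)  ≡⟨ cong -_ ≡0 ⟩
          0ℤ                 ∎)

    ℓ₁≤k∧M∣L⇒a+tb≡0 : ∀ a b r → ℓ₁ a b r ≤ k → M ∣ L a b r → a + t * b ≡ 0ℤ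
    ℓ₁≤k∧M∣L⇒a+tb≡0 a b r ℓ₁≤k (divides p L≡pM) with a + t * b ≟ 0ℤ
    ... | yes ≡0 = ≡0
    ... | no  ≢0 = ⊥-elim (<⇒≱ (L≡pM⇒k<ℓ₁ p a b r L≡pM ≢0) ℓ₁≤k)

module Labeling (t k : ℤ) (M : ℕ) .{{_ : ℕ.NonZero M}} where
  open import Data.Integer
  open import Data.Integer.DivMod using (_%ℕ_; _/ℕ_; a≡a%ℕn+[a/ℕn]*n; n%ℕd<d)
  open import Data.Integer.Divisibility.Signed using (_∣_; divides)
  open import Data.Integer.Properties using (module ≤-Reasoning)
  open import Data.Integer.Tactic.RingSolver using (solve)
  open ≤-Reasoning

  label : ℤ → ℕ
  label u = (k * u) %ℕ M

  label<M : ∀ u → label u ℕ.< M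
  label<M u = n%ℕd<d (k * u) M

  u-v+tk[cu-cv]≡multiple : ∀ X u v cu cv qu qv → + 2 * X ≡ t * k * k + + 1 →
    k * u ≡ cu + qu * X → k * v ≡ cv + qv * X →
    (u - v) + t * k * (cu - cv) ≡ (+ 2 * (u - v) - t * k * (qu - qv)) * X
  u-v+tk[cu-cv]≡multiple X u v cu cv qu qv 2X≡tk²+1 ku≡ kv≡ = begin-equality
    (u - v) + t * k * (cu - cv)
      ≡⟨ solve (t ∷ k ∷ X ∷ u ∷ v ∷ cu ∷ cv ∷ qu ∷ qv ∷ []) ⟩
    (u - v) + t * k * ((cu + qu * X) - (cv + qv * X)) - t * k * (qu - qv) * X
      ≡⟨ cong₂ (λ x y → (u - v) + t * k * (x - y) - t * k * (qu - qv) * X) ku≡ kv≡ ⟨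
    (u - v) + t * k * (k * u - k * v) - t * k * (qu - qv) * X
      ≡⟨ solve (t ∷ k ∷ X ∷ u ∷ v ∷ qu ∷ qv ∷ []) ⟩
    (u - v) * (t * k * k + + 1) - t * k * (qu - qv) * X
      ≡⟨ cong (λ x → (u - v) * x - t * k * (qu - qv) * X) 2X≡tk²+1 ⟨
    (u - v) * (+ 2 * X) - t * k * (qu - qv) * X
      ≡⟨ solve (t ∷ k ∷ X ∷ u ∷ v ∷ qu ∷ qv ∷ []) ⟩
    (+ 2 * (u - v) - t * k * (qu - qv)) * X ∎

  M∣u-v+tk[cu-cv] : + 2 * + M ≡ t * k * k + + 1 → ∀ u v → + M ∣ (u - v) + t * k * (+ label u - + label v)
  M∣u-v+tk[cu-cv] 2M≡tk²+1 u v = divides (+ 2 * (u - v) - t * k * (qu - qv))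
    (u-v+tk[cu-cv]≡multiple (+ M) u v (+ label u) (+ label v) qu qv 2M≡tk²+1
      (a≡a%ℕn+[a/ℕn]*n (k * u) M) (a≡a%ℕn+[a/ℕn]*n (k * v) M))
    where
      qu = (k * u) /ℕ M
      qv = (k * v) /ℕ M

module RadioLabeling (n m : ℕ) (1≤n : 1 ℕ.≤ n) where
  open import Data.Integer
  open import Data.Integer.Properties using (pos-*; *-assoc; i-j≡0⇒i≡j; module ≤-Reasoning)
  open import Data.Integer.Divisibility.Signed using (_∣_)
  import Data.Nat.Properties as ℕ
  open OddNumbers
  open DistanceGraph
  open ShortVectors

  t k M : ℕ
  t = 2 ℕ.* n ℕ.+ 1
  k = 2 ℕ.* m ℕ.+ 1
  M = ℕ.suc ℕ.⌊ t ℕ.* (k ℕ.* k) ℕ.∸ 1 /2⌋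

  odd-tk² : Odd (t ℕ.* (k ℕ.* k))
  odd-tk² = odd-* (n , refl) (odd-* (m , refl) (m , refl))

  2M≡tk²+1 : + 2 * + M ≡ + t * + k * + k + + 1
  2M≡tk²+1 = begin-equality
    + 2 * + M                     ≡⟨ pos-* 2 M ⟨
    + (2 ℕ.* M)                   ≡⟨ cong +_ (odd⇒2*suc⌊n∸1/2⌋≡n+1 odd-tk²) ⟩
    + (t ℕ.* (k ℕ.* k)) + + 1     ≡⟨ cong (_+ + 1) (trans (pos-* t (k ℕ.* k)) (cong (+ t *_) (pos-* k k))) ⟩
    + t * (+ k * + k) + + 1       ≡⟨ cong (_+ + 1) (*-assoc (+ t) (+ k) (+ k)) ⟨
    + t * + k * + k + + 1         ∎
    where open ≤-Reasoning

  open Lattice {+ t} {+ k} {+ n} {+ m} {+ M}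
    (cong (_+ + 1) (pos-* 2 n)) (+≤+ 1≤n) (cong (_+ + 1) (pos-* 2 m)) (+≤+ ℕ.z≤n) 2M≡tk²+1
  open Labeling (+ t) (+ k) M

  span : SpanAtMost label ℕ.⌊ t ℕ.* (k ℕ.* k) ℕ.∸ 1 /2⌋
  span x y = ℕ.≤-trans (ℕ.m<1+n⇒m≤n (label<M x)) (ℕ.m≤n+m _ (label y))

  radio : IsRadioLabeling (1 ∷ t ∷ []) k label
  radio u v d u≢v (walk , _) with walk-offset t walk
  ... | a , b , u-v≡ , ∣a∣+∣b∣≤d =
    ℕ.≮⇒≥ λ close → u≢v (i-j≡0⇒i≡j u v (trans u-v≡ (ℓ₁≤k∧M∣L⇒a+tb≡0 a b r (ℓ₁≤k close) M∣L)))
    where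
      r = + label u - + label v

      ℓ₁≤k : ∣ r ∣ ℕ.+ d ℕ.< k ℕ.+ 1 → ℓ₁ a b r ≤ + k
      ℓ₁≤k close = +≤+ (begin
        ∣ a ∣ ℕ.+ ∣ b ∣ ℕ.+ ∣ r ∣   ≤⟨ ℕ.+-monoˡ-≤ ∣ r ∣ ∣a∣+∣b∣≤d ⟩
        d ℕ.+ ∣ r ∣                 ≡⟨ ℕ.+-comm d ∣ r ∣ ⟩
        ∣ r ∣ ℕ.+ d                 ≤⟨ ℕ.m<1+n⇒m≤n (subst (∣ r ∣ ℕ.+ d ℕ.<_) (ℕ.+-comm k 1) close) ⟩
        k                           ∎)
        where open ℕ.≤-Reasoning

      M∣L : + M ∣ L a b r
      M∣L = subst (λ x → + M ∣ x + + t * + k * r) u-v≡ (M∣u-v+tk[cu-cv] 2M≡tk²+1 u v)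

  radio-labeling : RadioNumberAtMost (1 ∷ t ∷ []) k ℕ.⌊ t ℕ.* (k ℕ.* k) ℕ.∸ 1 /2⌋
  radio-labeling = label , radio , span

open import Data.Nat using (ℕ; zero; suc; z≤n; s≤s; _≤_; _*_; _∸_; ⌊_/2⌋)

theorem4 : (t k : ℕ) → Odd t → 3 ≤ t → Odd k → 1 ≤ k →
    RadioNumberAtMost (1 ∷ t ∷ []) k ⌊ (t * (k * k)) ∸ 1 /2⌋
-- The hypothesis 1 ≤ k is implied by k being odd.
theorem4 _ _ (zero , refl) (s≤s ()) _ _
theorem4 _ _ (suc n , refl) _ (m , refl) _ = RadioLabeling.radio-labeling (suc n) m (s≤s z≤n)
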